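{- For any monoid $M$ and any $k\ge0$, the clone $\mathsf{Arra}_k(M):=\mathbf{P}(M)/_{\equiv_{\mathrm{first}_k}}$ admits the presentation $(\mathcal{G}_M,\mathcal{R}'_M)$, where $\mathcal{R}'_M$ is the equivalence relation on $\mathbf{T}(\mathcal{G}_M)$ generated by $\mathcal{R}_M$ together with the equations (in arity $k+1$) $\mathrm{rc}_M(1^{\alpha_1}2^e1^{\alpha_2}3^e\cdots1^{\alpha_k}(k+1)^e1^{\alpha_{k+1}})\sim\mathrm{rc}_M(1^{\alpha_1}2^e1^{\alpha_2}3^e\cdots1^{\alpha_k}(k+1)^e)$ for all $\alpha_1,\dots,\alpha_{k+1}\in M$, where $e$ is the unit of $M$.
   Context: Clones: a clone $C$ is a graded set with superposition maps $C(n)\times C(m)^n\to C(m)$, $x[y_1,\dots,y_n]$, and projections $\mathbf{1}_{i,n}$ satisfying $\mathbf{1}_{i,n}[y_1,\dots,y_n]=y_i$, $x[\mathbf{1}_{1,n},\dots,\mathbf{1}_{n,n}]=x$ and $x[y_1,\dots,y_n][z_1,\dots,z_m]=x[y_1[z_1,\dots,z_m],\dots,y_n[z_1,\dots,z_m]]$; clone congruences are arity-preserving equivalence relations compatible with superposition. Let $(M,\cdot,e)$ be a monoid. $M$-pigmented letters are pairs $i^\alpha$ ($i\ge1$, $\alpha\in M$); $\mathbf{P}(M)(n)$ is the set of words of such letters with values in $[n]$. With $\alpha\odot i_1^{\alpha_1}\cdots i_\ell^{\alpha_\ell}:=i_1^{\alpha\alpha_1}\cdots i_\ell^{\alpha\alpha_\ell}$,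 $\mathbf{P}(M)$ is the clone with $i_1^{\alpha_1}\cdots i_\ell^{\alpha_\ell}[\mathfrak{p}_1,\dots,\mathfrak{p}_n]:=(\alpha_1\odot\mathfrak{p}_{i_1})\cdots(\alpha_\ell\odot\mathfrak{p}_{i_\ell})$ and projections $i^e$. A position $j$ of a word $\mathfrak{p}$ is a left $k$-witness if at most $k-1$ earlier letters have the same value as $\mathfrak{p}(j)$; $\mathrm{first}_k(\mathfrak{p})$ is the subword of letters at left $k$-witness positions; $\equiv_{\mathrm{first}_k}$ relates words of equal arity with equal $\mathrm{first}_k$; it is a clone congruence. Terms: $\mathbf{T}(\mathcal{G})(n)$ is the set of $\mathcal{G}$-terms with variables among $x_1,\dots,x_n$ (free clone: superposition = substitution, projections $x_i$). For $(\mathcal{G},\mathcal{R})$, $\equiv_{\mathcal{R}}$ is the smallest clone congruence containing $\mathcal{R}$; $(\mathcal{G},\mathcal{R})$ is a presentation of $C$ if $C\cong\mathbf{T}(\mathcal{G})/_{\equiv_{\mathcal{R}}}$. $\mathcal{G}_M(0)=\{\mathsf{u}\}$, $\mathcal{G}_M(1)=\{\mathsf{p}_\alpha:\alpha\in M\}$, $\mathcal{G}_M(2)=\{\star\}$; $\mathcal{R}_M$ is generated by $\star[\star[x_1,x_2],x_3]\sim\star[x_1,\star[x_2,x_3]]$, $\star[\mathsf{u},x_1]\sim x_1\sim\star[x_1,\mathsf{u}]$, $\mathsf{p}_\alpha[\star[x_1,x_2]]\sim\star[\mathsf{p}_\alpha[x_1],\mathsf{p}_\alpha[x_2]]$, $\mathsf{p}_\alpha[\mathsf{u}]\sim\mathsf{u}$,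 $\mathsf{p}_{\alpha_1}[\mathsf{p}_{\alpha_2}[x_1]]\sim\mathsf{p}_{\alpha_1\alpha_2}[x_1]$, $\mathsf{p}_e[x_1]\sim x_1$. Right comb map: $\mathrm{rc}_M(\epsilon)=\mathsf{u}$, $\mathrm{rc}_M(i^\alpha\mathfrak{p}')=\star[\mathsf{p}_\alpha[x_i],\mathrm{rc}_M(\mathfrak{p}')]$. -}

module Defs where

open import Data.Nat using (ℕ; zero; suc; _<?_)
open import Data.Fin using (Fin; zero; suc; inject₁; fromℕ; _≟_)
open import Data.List using (List; []; _∷_; _++_; concatMap; map; allFin)
open import Data.Product using (_×_; _,_)
open import Relation.Nullary using (yes; no)
open import Relation.Binary.PropositionalEquality using (_≡_)

record CloneSig : Set₁ where
  infix 4 _≈_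
  field
    Op   : ℕ → Set
    _≈_  : ∀ {n} → Op n → Op n → Set
    sup  : ∀ {n m} → Op n → (Fin n → Op m) → Op m
    proj : ∀ {n} → Fin n → Op n

record CloneIso (C D : CloneSig) : Set where
  private
    module C = CloneSig C
    module D = CloneSig D
  field
    to       : ∀ {n} → C.Op n → D.Op n
    from     : ∀ {n} → D.Op n → C.Op n
    to-cong  : ∀ {n} {x y : C.Op n} → x C.≈ y → to x D.≈ to y
    from-cong : ∀ {n} {x y : D.Op n} → x D.≈ y → from x C.≈ from y
    to-from  : ∀ {n} (y : D.Op n) → to (from y) D.≈ y
    from-to  : ∀ {n} (x : C.Op n) → from (to x) C.≈ x
    to-sup   : ∀ {n m} (x : C.Op n) (ys : Fin n → C.Op m) →
               to (C.sup x ys) D.≈ D.sup (to x) (λ i → to (ys i))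
    to-proj  : ∀ {n} (i : Fin n) → to (C.proj i) D.≈ D.proj i

Word : Set → ℕ → Set
Word M n = List (Fin n × M)

module _ {M : Set} (_∙_ : M → M → M) (e : M) where

  _⊙_ : ∀ {n} → M → Word M n → Word M n
  α ⊙ p = map (λ { (i , β) → (i , α ∙ β) }) p

  supP : ∀ {n m} → Word M n → (Fin n → Word M m) → Word M m
  supP w ps = concatMap (λ { (i , α) → α ⊙ ps i }) w

  projP : ∀ {n} → Fin n → Word M n
  projP i = (i , e) ∷ []

occ : ∀ {n} → Fin n → List (Fin n) → ℕ
occ i [] = 0
occ i (j ∷ js) with j ≟ i
... | yes _ = suc (occ i js)
... | no  _ = occ i js

firstFrom : ∀ {M : Set} {n} → ℕ → List (Fin n) → Word M n → Word M n
firstFrom k prev [] = []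
firstFrom k prev ((i , α) ∷ w) with occ i prev <? k
... | yes _ = (i , α) ∷ firstFrom k (i ∷ prev) w
... | no  _ = firstFrom k (i ∷ prev) w

first : ∀ {M : Set} {n} → ℕ → Word M n → Word M n
first k w = firstFrom k [] w

Arra : {M : Set} (_∙_ : M → M → M) (e : M) (k : ℕ) → CloneSig
Arra {M} _∙_ e k = record
  { Op   = Word M
  ; _≈_  = λ p q → first k p ≡ first k q
  ; sup  = supP _∙_ e
  ; proj = projP _∙_ e
  }

data Term (M : Set) (n : ℕ) : Set where
  var  : Fin n → Term M n
  u    : Term M n
  p    : M → Term M n → Term M n
  star : Term M n → Term M n → Term M n

subst : ∀ {M n m} → Term M n → (Fin n → Term M m) → Term M m
subst (var i)    σ = σ i
subst u          σ = u
subst (p α t)    σ = p α (subst t σ)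
subst (star s t) σ = star (subst s σ) (subst t σ)

x₁ x₂ x₃ : ∀ {M n} → Term M (suc n)
x₁ = var zero
x₂ {n = zero}  = u   -- unused dummy; arities below are always large enough
x₂ {n = suc n} = var (suc zero)
x₃ {n = zero}  = u
x₃ {n = suc zero} = u
x₃ {n = suc (suc n)} = var (suc (suc zero))

rc : ∀ {M n} → Word M n → Term M n
rc []            = u
rc ((i , α) ∷ w) = star (p α (var i)) (rc w)

module _ {M : Set} (_∙_ : M → M → M) (e : M) where

  -- the words 1^{α1} 2^e 1^{α2} 3^e ⋯ 1^{αk} (k+1)^e  (rhsWord)
  -- and the same followed by 1^{α_{k+1}}               (lhsWord)
  rhsWord : (k : ℕ) → (Fin (suc k) → M) → Word M (suc k)
  rhsWord k α = concatMap (λ j → (zero , α (inject₁ j)) ∷ (suc j , e) ∷ []) (allFin k)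

  lhsWord : (k : ℕ) → (Fin (suc k) → M) → Word M (suc k)
  lhsWord k α = rhsWord k α ++ ((zero , α (fromℕ k)) ∷ [])

  data Ax (k : ℕ) : ∀ {n} → Term M n → Term M n → Set where
    assoc  : Ax k {3} (star (star x₁ x₂) x₃) (star x₁ (star x₂ x₃))
    unitˡ  : Ax k {1} (star u x₁) x₁
    unitʳ  : Ax k {1} x₁ (star x₁ u)
    p-star : ∀ α → Ax k {2} (p α (star x₁ x₂)) (star (p α x₁) (p α x₂))
    p-u    : ∀ α → Ax k {0} (p α u) u
    p-p    : ∀ α β → Ax k {1} (p α (p β x₁)) (p (α ∙ β) x₁)
    p-e    : Ax k {1} (p e x₁) x₁
    k-eq   : ∀ (α : Fin (suc k) → M) →
             Ax k {suc k} (rc (lhsWord k α)) (rc (rhsWord k α))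

  data _≈R[_]_ : ∀ {n} → Term M n → ℕ → Term M n → Set where
    ax     : ∀ {k n} {s t : Term M n} → Ax k s t → s ≈R[ k ] t
    refl   : ∀ {k n} {s : Term M n} → s ≈R[ k ] s
    sym    : ∀ {k n} {s t : Term M n} → s ≈R[ k ] t → t ≈R[ k ] s
    trans  : ∀ {k n} {s t v : Term M n} → s ≈R[ k ] t → t ≈R[ k ] v → s ≈R[ k ] v
    sup-cong : ∀ {k n m} {s t : Term M n} {σ τ : Fin n → Term M m} →
               s ≈R[ k ] t → (∀ i → σ i ≈R[ k ] τ i) →
               subst s σ ≈R[ k ] subst t τ

  TQ : ℕ → CloneSig
  TQ k = record
    { Op   = Term M
    ; _≈_  = λ s t → s ≈R[ k ] t
    ; sup  = subst
    ; proj = var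
    }

module Submission where

open import Defs hiding (_⊙_; supP)
open import Algebra.Structures using (IsMonoid)
open import Data.Empty using (⊥-elim)
open import Data.Fin using (Fin; zero; suc; _≟_; inject₁; fromℕ)
open import Data.List using (List; []; _∷_; _++_; map; concat; tabulate)
open import Data.List.Properties
  using (++-assoc; ++-identityʳ; map-++; map-∘; map-tabulate; tabulate-cong; concatMap-++; concatMap-cong)
open import Data.List.Relation.Unary.All as All using (All; []; _∷_)
open import Data.Nat using (ℕ; zero; suc; _+_; _≤_; _<_; _<?_; z≤n; s≤s)
open import Data.Nat.Properties
  using (≤-refl; ≤-trans; ≤-pred; n≤1+n; m≤n+m; m≤n⇒m≤1+n; <⇒≱; ≮⇒≥; +-comm; +-suc; +-identityʳ; +-mono-≤;
         module ≤-Reasoning)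
open import Data.Product using (_×_; _,_; proj₁)
open import Data.Sum using (_⊎_; inj₁; inj₂)
open import Function using (_∘_; id)
open import Relation.Binary.Construct.Closure.ReflexiveTransitive using (Star; ε; _◅_; _◅◅_; gmap; fold; kleisliStar)
open import Relation.Binary.PropositionalEquality as ≡ using (_≡_; _≢_; refl; cong; cong₂; subst₂)
open import Relation.Nullary using (yes; no)

-- Call a letter redundant when its value already occurs k times to its left. Deleting a
-- redundant letter does not change first_k, and deleting redundant letters one by one turns
-- any word into its first_k, so ≡_{first_k} is the equivalence generated by such deletions.
-- Deletions are stable under superposition (a redundant letter i^α becomes a block of
-- redundant letters), hence ≡_{first_k} is a clone congruence and evaluating terms as words
-- respects R'_M. Conversely, the k occurrences of i to the left of a redundant letter i^α cut
-- the word in front of it into the shape  i^{β₁} w₁ i^{β₂} w₂ ⋯ i^{β_k} w_k ,  so modulo R_M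
-- (under which the right comb map and evaluation are mutually inverse) the deletion is an
-- instance of the extra equation.

module _ {n : ℕ} where

  occ-here : ∀ (i : Fin n) Q → occ i (i ∷ Q) ≡ suc (occ i Q)
  occ-here i Q with i ≟ i
  ... | yes _  = refl
  ... | no i≢i = ⊥-elim (i≢i refl)

  occ-there : ∀ {i j : Fin n} Q → i ≢ j → occ j (i ∷ Q) ≡ occ j Q
  occ-there {i} {j} Q i≢j with i ≟ j
  ... | yes i≡j = ⊥-elim (i≢j i≡j)
  ... | no _    = refl

  occ-++ : ∀ (i : Fin n) xs ys → occ i (xs ++ ys) ≡ occ i xs + occ i ys
  occ-++ i []       ys = refl
  occ-++ i (j ∷ xs) ys with j ≟ i
  ... | yes _ = cong suc (occ-++ i xs ys)
  ... | no  _ = occ-++ i xs ys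

  occ-∷ʳ : ∀ (j : Fin n) xs i → occ j (xs ++ i ∷ []) ≡ occ j (i ∷ xs)
  occ-∷ʳ j xs i =
    ≡.trans (occ-++ j xs (i ∷ [])) (≡.trans (+-comm (occ j xs) _) (≡.sym (occ-++ j (i ∷ []) xs)))

  occ-∷-≤ : ∀ (j x : Fin n) xs → occ j xs ≤ occ j (x ∷ xs)
  occ-∷-≤ j x xs with x ≟ j
  ... | yes _ = n≤1+n _
  ... | no  _ = ≤-refl

  occ-members : ∀ (xs : List (Fin n)) → All (λ j → 1 ≤ occ j xs) xs
  occ-members []       = []
  occ-members (x ∷ xs) = ≡.subst (1 ≤_) (≡.sym (occ-here x xs)) (s≤s z≤n)
                       ∷ All.map (λ {j} h → ≤-trans h (occ-∷-≤ j x xs)) (occ-members xs)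

module _ {M : Set} where

  vals : ∀ {n} → Word M n → List (Fin n)
  vals = map proj₁

  occ-vals-++ : ∀ {n} (j : Fin n) (xs ys : Word M n) →
                occ j (vals (xs ++ ys)) ≡ occ j (vals xs) + occ j (vals ys)
  occ-vals-++ j xs ys = ≡.trans (cong (occ j) (map-++ proj₁ xs ys)) (occ-++ j (vals xs) (vals ys))

  seen : ∀ {n} → List (Fin n) → Word M n → List (Fin n)
  seen Q []            = Q
  seen Q ((i , _) ∷ w) = seen (i ∷ Q) w

  occ-seen : ∀ {n} (j : Fin n) Q (w : Word M n) → occ j (seen Q w) ≡ occ j (vals w) + occ j Q
  occ-seen j Q []            = refl
  occ-seen j Q ((i , _) ∷ w) with i ≟ j
  ... | yes refl =
    ≡.trans (occ-seen i (i ∷ Q) w) (≡.trans (cong (occ i (vals w) +_) (occ-here i Q)) (+-suc _ _))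
  ... | no i≢j   = ≡.trans (occ-seen j (i ∷ Q) w) (cong (occ j (vals w) +_) (occ-there Q i≢j))

  interleave : ∀ {n m} → Fin n → (Fin m → M) → (Fin m → Word M n) → Word M n
  interleave i β c = concat (tabulate (λ j → (i , β j) ∷ c j))

  occ-interleave : ∀ {n} m (i : Fin n) β c → m ≤ occ i (vals (interleave {m = m} i β c))
  occ-interleave zero    i β c = z≤n
  occ-interleave (suc m) i β c = begin
    suc m                                              ≤⟨ s≤s (occ-interleave m i (β ∘ suc) (c ∘ suc)) ⟩
    suc (occ i (vals rest))                            ≤⟨ s≤s (m≤n+m _ _) ⟩
    suc (occ i (vals (c zero)) + occ i (vals rest))    ≡⟨ cong suc (occ-vals-++ i (c zero) rest) ⟨
    suc (occ i (vals (c zero ++ rest)))                ≡⟨ occ-here i (vals (c zero ++ rest)) ⟨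
    occ i (vals (interleave i β c))                    ∎
    where
    open ≤-Reasoning
    rest : Word M _
    rest = interleave i (β ∘ suc) (c ∘ suc)

  record Interleaving {n} (m : ℕ) (i : Fin n) (b : Word M n) : Set where
    field
      prefix   : Word M n
      pigments : Fin m → M
      gaps     : Fin m → Word M n
      split    : b ≡ prefix ++ interleave i pigments gaps

  interleaving : ∀ {n} m (i : Fin n) b → m ≤ occ i (vals b) → Interleaving m i b
  interleaving zero    i b              _     = record
    { prefix   = b
    ; pigments = λ ()
    ; gaps     = λ ()
    ; split    = ≡.sym (++-identityʳ b)
    }
  interleaving (suc m) i []             ()
  interleaving (suc m) i ((i′ , α) ∷ b) m<occ with i′ ≟ i
  ... | yes refl = record
    { prefix   = []
    ; pigments = λ { zero → α ; (suc j) → pigments j }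
    ; gaps     = λ { zero → prefix ; (suc j) → gaps j }
    ; split    = cong ((i , α) ∷_) split
    }
    where open Interleaving (interleaving m i b (≤-pred m<occ))
  ... | no _ = record
    { prefix   = (i′ , α) ∷ prefix
    ; pigments = pigments
    ; gaps     = gaps
    ; split    = cong ((i′ , α) ∷_) split
    }
    where open Interleaving (interleaving (suc m) i b m<occ)

module Deletion {M : Set} (k : ℕ) where

  infix 4 _≈ₖ_ _≋ₖ_

  -- firstFrom k Q depends on Q only through the occurrence counts of its values capped at k.
  _≈ₖ_ : ℕ → ℕ → Set
  a ≈ₖ b = a ≡ b ⊎ (k ≤ a × k ≤ b)

  ≈ₖ-sym : ∀ {a b} → a ≈ₖ b → b ≈ₖ a
  ≈ₖ-sym (inj₁ a≡b)         = inj₁ (≡.sym a≡b)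
  ≈ₖ-sym (inj₂ (k≤a , k≤b)) = inj₂ (k≤b , k≤a)

  ≈ₖ-trans : ∀ {a b c} → a ≈ₖ b → b ≈ₖ c → a ≈ₖ c
  ≈ₖ-trans (inj₁ refl)      b≈c               = b≈c
  ≈ₖ-trans (inj₂ saturated)     (inj₁ refl)       = inj₂ saturated
  ≈ₖ-trans (inj₂ (k≤a , _)) (inj₂ (_ , k≤c))  = inj₂ (k≤a , k≤c)

  ≈ₖ-suc : ∀ {a b} → a ≈ₖ b → suc a ≈ₖ suc b
  ≈ₖ-suc (inj₁ a≡b)         = inj₁ (cong suc a≡b)
  ≈ₖ-suc (inj₂ (k≤a , k≤b)) = inj₂ (m≤n⇒m≤1+n k≤a , m≤n⇒m≤1+n k≤b)

  ≈ₖ-< : ∀ {a b} → a ≈ₖ b → a < k → b < k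
  ≈ₖ-< (inj₁ refl)      a<k = a<k
  ≈ₖ-< (inj₂ (k≤a , _)) a<k = ⊥-elim (<⇒≱ a<k k≤a)

  ≈ₖ-≥ : ∀ {a b} → a ≈ₖ b → k ≤ a → k ≤ b
  ≈ₖ-≥ (inj₁ refl)      k≤a = k≤a
  ≈ₖ-≥ (inj₂ (_ , k≤b)) _   = k≤b

  _≋ₖ_ : ∀ {n} → List (Fin n) → List (Fin n) → Set
  Q ≋ₖ Q′ = ∀ j → occ j Q ≈ₖ occ j Q′

  ≋ₖ-∷ : ∀ {n} {Q Q′ : List (Fin n)} i → Q ≋ₖ Q′ → i ∷ Q ≋ₖ i ∷ Q′
  ≋ₖ-∷ i Q≋Q′ j with i ≟ j
  ... | yes refl = ≈ₖ-suc (Q≋Q′ i)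
  ... | no  _    = Q≋Q′ j

  ≋ₖ-∷-saturated : ∀ {n} {Q : List (Fin n)} i → k ≤ occ i Q → i ∷ Q ≋ₖ Q
  ≋ₖ-∷-saturated i k≤occ j with i ≟ j
  ... | yes refl = inj₂ (m≤n⇒m≤1+n k≤occ , k≤occ)
  ... | no  _    = inj₁ refl

  firstFrom-cong : ∀ {n} {Q Q′ : List (Fin n)} → Q ≋ₖ Q′ → (w : Word M n) →
                   firstFrom k Q w ≡ firstFrom k Q′ w
  firstFrom-cong Q≋Q′ [] = refl
  firstFrom-cong {Q = Q} {Q′} Q≋Q′ ((i , α) ∷ w) with occ i Q <? k | occ i Q′ <? k
  ... | yes _  | yes _  = cong ((i , α) ∷_) (firstFrom-cong (≋ₖ-∷ i Q≋Q′) w)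
  ... | no  _  | no  _  = firstFrom-cong (≋ₖ-∷ i Q≋Q′) w
  ... | yes lt | no ¬lt = ⊥-elim (¬lt (≈ₖ-< (Q≋Q′ i) lt))
  ... | no ¬lt | yes lt = ⊥-elim (¬lt (≈ₖ-< (≈ₖ-sym (Q≋Q′ i)) lt))

  firstFrom-++ : ∀ {n} (Q : List (Fin n)) (xs ys : Word M n) →
                 firstFrom k Q (xs ++ ys) ≡ firstFrom k Q xs ++ firstFrom k (seen Q xs) ys
  firstFrom-++ Q []             ys = refl
  firstFrom-++ Q ((i , α) ∷ xs) ys with occ i Q <? k
  ... | yes _ = cong ((i , α) ∷_) (firstFrom-++ (i ∷ Q) xs ys)
  ... | no  _ = firstFrom-++ (i ∷ Q) xs ys

  firstFrom-saturated : ∀ {n} {Q : List (Fin n)} i α w → k ≤ occ i Q →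
                        firstFrom k Q ((i , α) ∷ w) ≡ firstFrom k Q w
  firstFrom-saturated {Q = Q} i α w k≤occ with occ i Q <? k
  ... | yes occ<k = ⊥-elim (<⇒≱ occ<k k≤occ)
  ... | no  _     = firstFrom-cong (≋ₖ-∷-saturated i k≤occ) w

  infix 4 _↝_ _↝*_

  data _↝_ {n} : Word M n → Word M n → Set where
    delete : ∀ b i α w → k ≤ occ i (vals b) → b ++ (i , α) ∷ w ↝ b ++ w

  _↝*_ : ∀ {n} → Word M n → Word M n → Set
  _↝*_ = Star _↝_

  first-↝ : ∀ {n} {w w′ : Word M n} → w ↝ w′ → first k w ≡ first k w′
  first-↝ (delete b i α w k≤occ) = begin
    firstFrom k [] (b ++ (i , α) ∷ w)                         ≡⟨ firstFrom-++ [] b _ ⟩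
    firstFrom k [] b ++ firstFrom k (seen [] b) ((i , α) ∷ w) ≡⟨ cong (firstFrom k [] b ++_) skip ⟩
    firstFrom k [] b ++ firstFrom k (seen [] b) w             ≡⟨ firstFrom-++ [] b w ⟨
    firstFrom k [] (b ++ w)                                   ∎
    where
    open ≡.≡-Reasoning
    k≤seen : k ≤ occ i (seen [] b)
    k≤seen = ≡.subst (k ≤_) (≡.sym (≡.trans (occ-seen i [] b) (+-identityʳ _))) k≤occ
    skip : firstFrom k (seen [] b) ((i , α) ∷ w) ≡ firstFrom k (seen [] b) w
    skip = firstFrom-saturated i α w k≤seen

  first-↝* : ∀ {n} {w w′ : Word M n} → w ↝* w′ → first k w ≡ first k w′
  first-↝* = fold (λ w w′ → first k w ≡ first k w′) (λ s → ≡.trans (first-↝ s)) refl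

  ↝-++ˡ : ∀ {n} (a : Word M n) {w w′} → w ↝ w′ → a ++ w ↝ a ++ w′
  ↝-++ˡ a (delete b i α w k≤occ) =
    subst₂ _↝_ (++-assoc a b _) (++-assoc a b w) (delete (a ++ b) i α w k≤occ′)
    where
    k≤occ′ : k ≤ occ i (vals (a ++ b))
    k≤occ′ = ≡.subst (k ≤_) (≡.sym (occ-vals-++ i a b)) (≤-trans k≤occ (m≤n+m _ _))

  ↝-++ʳ : ∀ {n} (c : Word M n) {w w′} → w ↝ w′ → w ++ c ↝ w′ ++ c
  ↝-++ʳ c (delete b i α w k≤occ) =
    subst₂ _↝_ (≡.sym (++-assoc b _ c)) (≡.sym (++-assoc b w c)) (delete b i α (w ++ c) k≤occ)

  ↝*-++ˡ : ∀ {n} (a : Word M n) {w w′} → w ↝* w′ → a ++ w ↝* a ++ w′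
  ↝*-++ˡ a = gmap (a ++_) (↝-++ˡ a)

  ↝*-++ʳ : ∀ {n} (c : Word M n) {w w′} → w ↝* w′ → w ++ c ↝* w′ ++ c
  ↝*-++ʳ c = gmap (_++ c) (↝-++ʳ c)

  ↝*-delete-all : ∀ {n} (b d w : Word M n) → All (λ j → k ≤ occ j (vals b)) (vals d) →
                  b ++ d ++ w ↝* b ++ w
  ↝*-delete-all b []            w []                = ε
  ↝*-delete-all b ((j , β) ∷ d) w (k≤occ ∷ k≤occs) =
    delete b j β (d ++ w) k≤occ ◅ ↝*-delete-all b d w k≤occs

  -- b is the part of first_k already produced and Q the values read so far.
  ↝*-firstFrom : ∀ {n} (b : Word M n) Q → Q ≋ₖ vals b → ∀ w → b ++ w ↝* b ++ firstFrom k Q w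
  ↝*-firstFrom b Q Q≋b []            = ε
  ↝*-firstFrom b Q Q≋b ((i , α) ∷ w) with occ i Q <? k
  ... | yes _ =
    subst₂ _↝*_ (++-assoc b _ w) (++-assoc b _ (firstFrom k (i ∷ Q) w))
      (↝*-firstFrom (b ++ (i , α) ∷ []) (i ∷ Q) iQ≋bi w)
    where
    iQ≋bi : i ∷ Q ≋ₖ vals (b ++ (i , α) ∷ [])
    iQ≋bi j = ≡.subst (occ j (i ∷ Q) ≈ₖ_)
                (≡.sym (≡.trans (cong (occ j) (map-++ proj₁ b _)) (occ-∷ʳ j (vals b) i)))
                (≋ₖ-∷ i Q≋b j)
  ... | no ¬occ<k = delete b i α w k≤occ ◅ ↝*-firstFrom b (i ∷ Q) iQ≋b w
    where
    k≤occ : k ≤ occ i (vals b)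
    k≤occ = ≈ₖ-≥ (Q≋b i) (≮⇒≥ ¬occ<k)
    iQ≋b : i ∷ Q ≋ₖ vals b
    iQ≋b j = ≈ₖ-trans (≋ₖ-∷-saturated i (≮⇒≥ ¬occ<k) j) (Q≋b j)

  ↝*-first : ∀ {n} (w : Word M n) → w ↝* first k w
  ↝*-first = ↝*-firstFrom [] [] (λ _ → inj₁ refl)

module Pigmented {M : Set} (_∙_ : M → M → M) (e : M) where

  infixr 6 _⊙_

  _⊙_ : ∀ {n} → M → Word M n → Word M n
  _⊙_ = Defs._⊙_ _∙_ e

  supP : ∀ {n m} → Word M n → (Fin n → Word M m) → Word M m
  supP = Defs.supP _∙_ e

  ⊙-++ : ∀ {n} α (xs ys : Word M n) → α ⊙ (xs ++ ys) ≡ α ⊙ xs ++ α ⊙ ys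
  ⊙-++ α = map-++ _

  vals-⊙ : ∀ {n} α (w : Word M n) → vals (α ⊙ w) ≡ vals w
  vals-⊙ α w = ≡.sym (map-∘ w)

  supP-++ : ∀ {n m} (xs ys : Word M n) (F : Fin n → Word M m) →
            supP (xs ++ ys) F ≡ supP xs F ++ supP ys F
  supP-++ xs ys F = concatMap-++ _ xs ys

  supP-cong : ∀ {n m} (w : Word M n) {F G : Fin n → Word M m} → (∀ i → F i ≡ G i) →
              supP w F ≡ supP w G
  supP-cong w F≗G = concatMap-cong (λ { (i , α) → cong (α ⊙_) (F≗G i) }) w

  supP-concat : ∀ {n m} (ws : List (Word M n)) (F : Fin n → Word M m) →
                supP (concat ws) F ≡ concat (map (λ w → supP w F) ws)
  supP-concat []       F = refl
  supP-concat (w ∷ ws) F = ≡.trans (supP-++ w (concat ws) F) (cong (supP w F ++_) (supP-concat ws F))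

  occ-supP : ∀ {n m} (b : Word M n) (F : Fin n → Word M m) i j → 1 ≤ occ j (vals (F i)) →
             occ i (vals b) ≤ occ j (vals (supP b F))
  occ-supP []             F i j j∈Fi = z≤n
  occ-supP ((i′ , α) ∷ b) F i j j∈Fi =
    ≡.subst (occ i (i′ ∷ vals b) ≤_) (≡.sym occ-block) bound
    where
    occ-block : occ j (vals (supP ((i′ , α) ∷ b) F)) ≡ occ j (vals (F i′)) + occ j (vals (supP b F))
    occ-block = ≡.trans (occ-vals-++ j (α ⊙ F i′) (supP b F))
                        (cong (λ vs → occ j vs + occ j (vals (supP b F))) (vals-⊙ α (F i′)))
    bound : occ i (i′ ∷ vals b) ≤ occ j (vals (F i′)) + occ j (vals (supP b F))
    bound with i′ ≟ i
    ... | yes refl = +-mono-≤ j∈Fi (occ-supP b F i j j∈Fi)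
    ... | no  _    = ≤-trans (occ-supP b F i j j∈Fi) (m≤n+m _ _)

  module _ (k : ℕ) where
    open Deletion {M} k

    ↝-⊙ : ∀ {n} α {w w′ : Word M n} → w ↝ w′ → α ⊙ w ↝ α ⊙ w′
    ↝-⊙ α (delete b i β w k≤occ) =
      subst₂ _↝_ (≡.sym (⊙-++ α b _)) (≡.sym (⊙-++ α b w))
        (delete (α ⊙ b) i (α ∙ β) (α ⊙ w)
                (≡.subst (λ vs → k ≤ occ i vs) (≡.sym (vals-⊙ α b)) k≤occ))

    ↝*-supPˡ : ∀ {n m} {w w′ : Word M n} (F : Fin n → Word M m) → w ↝* w′ →
               supP w F ↝* supP w′ F
    ↝*-supPˡ F = kleisliStar (λ w → supP w F) deleteBlock
      where
      deleteBlock : ∀ {w w′} → w ↝ w′ → supP w F ↝* supP w′ F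
      deleteBlock (delete b i α w k≤occ) =
        subst₂ _↝*_ (≡.sym (supP-++ b _ F)) (≡.sym (supP-++ b w F))
          (↝*-delete-all (supP b F) (α ⊙ F i) (supP w F)
            (≡.subst (All _) (≡.sym (vals-⊙ α (F i)))
              (All.map (λ {j} j∈Fi → ≤-trans k≤occ (occ-supP b F i j j∈Fi))
                       (occ-members (vals (F i))))))

    ↝*-supPʳ : ∀ {n m} (w : Word M n) {F G : Fin n → Word M m} → (∀ i → F i ↝* G i) →
               supP w F ↝* supP w G
    ↝*-supPʳ []            F↝*G = ε
    ↝*-supPʳ ((i , α) ∷ w) {F} {G} F↝*G =
      ↝*-++ʳ (supP w F) (gmap (α ⊙_) (↝-⊙ α) (F↝*G i)) ◅◅ ↝*-++ˡ (α ⊙ G i) (↝*-supPʳ w F↝*G)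

    first-supP : ∀ {n m} (w w′ : Word M n) (F G : Fin n → Word M m) →
                 first k w ≡ first k w′ → (∀ i → first k (F i) ≡ first k (G i)) →
                 first k (supP w F) ≡ first k (supP w′ G)
    first-supP w w′ F G w≡w′ F≡G = begin
      first k (supP w F)                 ≡⟨ first-↝* (↝*-supPʳ w {F} (↝*-first ∘ F)) ⟩
      first k (supP w (first k ∘ F))     ≡⟨ cong (first k) (supP-cong w F≡G) ⟩
      first k (supP w (first k ∘ G))     ≡⟨ first-↝* (↝*-supPʳ w {G} (↝*-first ∘ G)) ⟨
      first k (supP w G)                 ≡⟨ first-↝* (↝*-supPˡ G (↝*-first w)) ⟩
      first k (supP (first k w) G)       ≡⟨ cong (λ v → first k (supP v G)) w≡w′ ⟩
      first k (supP (first k w′) G)      ≡⟨ first-↝* (↝*-supPˡ G (↝*-first w′)) ⟨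
      first k (supP w′ G)                ∎
      where open ≡.≡-Reasoning

module Evaluation {M : Set} (_∙_ : M → M → M) (e : M) (isMonoid : IsMonoid _≡_ _∙_ e) where
  open IsMonoid isMonoid using (identityˡ; identityʳ) renaming (assoc to ∙-assoc)
  open Pigmented _∙_ e

  ⊙-identityˡ : ∀ {n} (w : Word M n) → e ⊙ w ≡ w
  ⊙-identityˡ []            = refl
  ⊙-identityˡ ((i , β) ∷ w) = cong₂ _∷_ (cong (i ,_) (identityˡ β)) (⊙-identityˡ w)

  ⊙-⊙ : ∀ {n} α β (w : Word M n) → α ⊙ β ⊙ w ≡ (α ∙ β) ⊙ w
  ⊙-⊙ α β []            = refl
  ⊙-⊙ α β ((i , γ) ∷ w) = cong₂ _∷_ (cong (i ,_) (≡.sym (∙-assoc α β γ))) (⊙-⊙ α β w)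

  ⊙-supP : ∀ {n m} α (w : Word M n) (F : Fin n → Word M m) → α ⊙ supP w F ≡ supP (α ⊙ w) F
  ⊙-supP α []            F = refl
  ⊙-supP α ((i , β) ∷ w) F =
    ≡.trans (⊙-++ α (β ⊙ F i) (supP w F)) (cong₂ _++_ (⊙-⊙ α β (F i)) (⊙-supP α w F))

  eval : ∀ {n} → Term M n → Word M n
  eval (var i)    = (i , e) ∷ []
  eval u          = []
  eval (p α t)    = α ⊙ eval t
  eval (star s t) = eval s ++ eval t

  eval-rc : ∀ {n} (w : Word M n) → eval (rc w) ≡ w
  eval-rc []            = refl
  eval-rc ((i , α) ∷ w) = cong₂ _∷_ (cong (i ,_) (identityʳ α)) (eval-rc w)

  eval-subst : ∀ {n m} (t : Term M n) (σ : Fin n → Term M m) →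
               eval (subst t σ) ≡ supP (eval t) (eval ∘ σ)
  eval-subst (var i)    σ = ≡.sym (≡.trans (++-identityʳ _) (⊙-identityˡ (eval (σ i))))
  eval-subst u          σ = refl
  eval-subst (p α t)    σ = ≡.trans (cong (α ⊙_) (eval-subst t σ)) (⊙-supP α (eval t) (eval ∘ σ))
  eval-subst (star s t) σ =
    ≡.trans (cong₂ _++_ (eval-subst s σ) (eval-subst t σ))
            (≡.sym (supP-++ (eval s) (eval t) (eval ∘ σ)))

  eval-subst-rc : ∀ {n m} (w : Word M n) (σ : Fin n → Term M m) →
                  eval (subst (rc w) σ) ≡ supP w (eval ∘ σ)
  eval-subst-rc w σ = ≡.trans (eval-subst (rc w) σ) (cong (λ v → supP v (eval ∘ σ)) (eval-rc w))

module Presentation {M : Set} (_∙_ : M → M → M) (e : M) (isMonoid : IsMonoid _≡_ _∙_ e) (k : ℕ) where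
  open IsMonoid isMonoid using (identityˡ; identityʳ) renaming (assoc to ∙-assoc)
  open Pigmented _∙_ e
  open Deletion {M} k
  open Evaluation _∙_ e isMonoid public

  infix 4 _≈_

  _≈_ : ∀ {n} → Term M n → Term M n → Set
  s ≈ t = _≈R[_]_ _∙_ e s k t

  ≈-reflexive : ∀ {n} {s t : Term M n} → s ≡ t → s ≈ t
  ≈-reflexive refl = refl

  ax-subst : ∀ {n m} {s t : Term M n} → Ax _∙_ e k s t → (σ : Fin n → Term M m) →
             subst s σ ≈ subst t σ
  ax-subst s~t σ = sup-cong (ax s~t) (λ _ → refl)

  star-cong : ∀ {n} {a a′ b b′ : Term M n} → a ≈ a′ → b ≈ b′ → star a b ≈ star a′ b′
  star-cong {a = a} {a′} {b} {b′} a≈a′ b≈b′ =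
    sup-cong {n = 2} {s = star (var zero) (var (suc zero))}
             {σ = λ { zero → a ; (suc _) → b }} {τ = λ { zero → a′ ; (suc _) → b′ }}
             refl (λ { zero → a≈a′ ; (suc _) → b≈b′ })

  p-cong : ∀ {n} α {a a′ : Term M n} → a ≈ a′ → p α a ≈ p α a′
  p-cong α {a} {a′} a≈a′ =
    sup-cong {n = 1} {s = p α (var zero)} {σ = λ _ → a} {τ = λ _ → a′} refl (λ _ → a≈a′)

  rc-++ : ∀ {n} (a b : Word M n) → rc (a ++ b) ≈ star (rc a) (rc b)
  rc-++ []            b = sym (ax-subst unitˡ (λ _ → rc b))
  rc-++ ((i , α) ∷ a) b =
    trans (star-cong refl (rc-++ a b))
          (sym (ax-subst assoc (λ { zero → p α (var i) ; (suc zero) → rc a ; (suc (suc _)) → rc b })))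

  rc-⊙ : ∀ {n} α (w : Word M n) → rc (α ⊙ w) ≈ p α (rc w)
  rc-⊙ α []            = sym (ax-subst (p-u α) (λ ()))
  rc-⊙ α ((i , β) ∷ w) =
    trans (star-cong (sym (ax-subst (p-p α β) (λ _ → var i))) (rc-⊙ α w))
          (sym (ax-subst (p-star α) (λ { zero → p β (var i) ; (suc _) → rc w })))

  rc-eval : ∀ {n} (t : Term M n) → rc (eval t) ≈ t
  rc-eval (var i)    = trans (sym (ax-subst unitʳ (λ _ → p e (var i)))) (ax-subst p-e (λ _ → var i))
  rc-eval u          = refl
  rc-eval (p α t)    = trans (rc-⊙ α (eval t)) (p-cong α (rc-eval t))
  rc-eval (star s t) = trans (rc-++ (eval s) (eval t)) (star-cong (rc-eval s) (rc-eval t))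

  ≈-from-eval : ∀ {n} {s t : Term M n} → eval s ≡ eval t → s ≈ t
  ≈-from-eval {s = s} {t} eval-s≡eval-t =
    trans (sym (rc-eval s)) (trans (≈-reflexive (cong rc eval-s≡eval-t)) (rc-eval t))

  rc-++-cong : ∀ {n} {x x′ y y′ : Word M n} → rc x ≈ rc x′ → rc y ≈ rc y′ →
               rc (x ++ y) ≈ rc (x′ ++ y′)
  rc-++-cong {x = x} {x′} {y} {y′} x≈x′ y≈y′ =
    trans (rc-++ x y) (trans (star-cong x≈x′ y≈y′) (sym (rc-++ x′ y′)))

  rc-supP : ∀ {n m} (w : Word M n) (F : Fin n → Word M m) → rc (supP w F) ≈ subst (rc w) (rc ∘ F)
  rc-supP w F = ≈-from-eval (begin
    eval (rc (supP w F))            ≡⟨ eval-rc (supP w F) ⟩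
    supP w F                        ≡⟨ supP-cong w (eval-rc ∘ F) ⟨
    supP w (eval ∘ rc ∘ F)          ≡⟨ eval-subst-rc w (rc ∘ F) ⟨
    eval (subst (rc w) (rc ∘ F))    ∎)
    where open ≡.≡-Reasoning

  rhsWord-interleave : ∀ (α : Fin (suc k) → M) →
                       rhsWord _∙_ e k α ≡ interleave zero (α ∘ inject₁) (λ j → (suc j , e) ∷ [])
  rhsWord-interleave α =
    cong concat (map-tabulate id (λ j → (zero , α (inject₁ j)) ∷ (suc j , e) ∷ []))

  first-lhsWord : ∀ α → first k (lhsWord _∙_ e k α) ≡ first k (rhsWord _∙_ e k α)
  first-lhsWord α =
    ≡.trans (first-↝ (delete (rhsWord _∙_ e k α) zero (α (fromℕ k)) [] k≤occ))
            (cong (first k) (++-identityʳ (rhsWord _∙_ e k α)))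
    where
    k≤occ : k ≤ occ zero (vals (rhsWord _∙_ e k α))
    k≤occ = ≡.subst (λ w → k ≤ occ zero (vals w)) (≡.sym (rhsWord-interleave α))
                    (occ-interleave k zero _ _)

  first-axiom : ∀ {n} {s t : Term M n} → Ax _∙_ e k s t → first k (eval s) ≡ first k (eval t)
  first-axiom assoc      = refl
  first-axiom unitˡ      = refl
  first-axiom unitʳ      = refl
  first-axiom (p-star α) = refl
  first-axiom (p-u α)    = refl
  first-axiom (p-p α β)  = cong (λ γ → first k ((zero , γ) ∷ [])) (≡.sym (∙-assoc α β e))
  first-axiom p-e        = cong (λ γ → first k ((zero , γ) ∷ [])) (identityˡ e)
  first-axiom (k-eq α)   = begin
    first k (eval (rc (lhsWord _∙_ e k α)))  ≡⟨ cong (first k) (eval-rc (lhsWord _∙_ e k α)) ⟩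
    first k (lhsWord _∙_ e k α)              ≡⟨ first-lhsWord α ⟩
    first k (rhsWord _∙_ e k α)              ≡⟨ cong (first k) (eval-rc (rhsWord _∙_ e k α)) ⟨
    first k (eval (rc (rhsWord _∙_ e k α)))  ∎
    where open ≡.≡-Reasoning

  eval-cong : ∀ {n} {s t : Term M n} → s ≈ t → first k (eval s) ≡ first k (eval t)
  eval-cong (ax s~t)        = first-axiom s~t
  eval-cong refl            = refl
  eval-cong (sym t≈s)       = ≡.sym (eval-cong t≈s)
  eval-cong (trans r≈s s≈t) = ≡.trans (eval-cong r≈s) (eval-cong s≈t)
  eval-cong (sup-cong {s = s} {t} {σ} {τ} s≈t σ≈τ) = begin
    first k (eval (subst s σ))            ≡⟨ cong (first k) (eval-subst s σ) ⟩
    first k (supP (eval s) (eval ∘ σ))    ≡⟨ first-supP k (eval s) (eval t) (eval ∘ σ) (eval ∘ τ)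
                                                        (eval-cong s≈t) (eval-cong ∘ σ≈τ) ⟩
    first k (supP (eval t) (eval ∘ τ))    ≡⟨ cong (first k) (eval-subst t τ) ⟨
    first k (eval (subst t τ))            ∎
    where open ≡.≡-Reasoning

  snoc : ∀ {m} → (Fin m → M) → M → Fin (suc m) → M
  snoc {zero}  β α _       = α
  snoc {suc m} β α zero    = β zero
  snoc {suc m} β α (suc j) = snoc (β ∘ suc) α j

  snoc-inject₁ : ∀ {m} (β : Fin m → M) α j → snoc β α (inject₁ j) ≡ β j
  snoc-inject₁ β α zero    = refl
  snoc-inject₁ β α (suc j) = snoc-inject₁ (β ∘ suc) α j

  snoc-last : ∀ m (β : Fin m → M) α → snoc β α (fromℕ m) ≡ α
  snoc-last zero    β α = refl
  snoc-last (suc m) β α = snoc-last m (β ∘ suc) α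

  rc-interleave-∷ʳ : ∀ {n} (i : Fin n) β c α →
                     rc (interleave i β c ++ (i , α) ∷ []) ≈ rc (interleave {m = k} i β c)
  rc-interleave-∷ʳ {n} i β c α =
    trans (≈-from-eval eval-lhs) (trans (ax-subst (k-eq (snoc β α)) σ) (≈-from-eval eval-rhs))
    where
    σ : Fin (suc k) → Term M n
    σ zero    = var i
    σ (suc j) = rc (c j)

    F : Fin (suc k) → Word M n
    F = eval ∘ σ

    lhs rhs : Word M (suc k)
    lhs = lhsWord _∙_ e k (snoc β α)
    rhs = rhsWord _∙_ e k (snoc β α)

    block : Fin k → Word M (suc k)
    block j = (zero , snoc β α (inject₁ j)) ∷ (suc j , e) ∷ []

    supP-block : ∀ j → supP (block j) F ≡ (i , β j) ∷ c j
    supP-block j = cong₂ _∷_ (cong (i ,_) (≡.trans (identityʳ _) (snoc-inject₁ β α j)))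
                             (≡.trans (++-identityʳ _) (≡.trans (⊙-identityˡ _) (eval-rc (c j))))

    supP-rhs : supP rhs F ≡ interleave i β c
    supP-rhs = begin
      supP rhs F                                      ≡⟨ cong (λ w → supP w F) (rhsWord-interleave (snoc β α)) ⟩
      supP (concat (tabulate block)) F                ≡⟨ supP-concat (tabulate block) F ⟩
      concat (map (λ w → supP w F) (tabulate block))  ≡⟨ cong concat (map-tabulate block (λ w → supP w F)) ⟩
      concat (tabulate (λ j → supP (block j) F))      ≡⟨ cong concat (tabulate-cong supP-block) ⟩
      interleave i β c                                ∎
      where open ≡.≡-Reasoning

    eval-rhs : eval (subst (rc rhs) σ) ≡ eval (rc (interleave i β c))
    eval-rhs = ≡.trans (eval-subst-rc rhs σ) (≡.trans supP-rhs (≡.sym (eval-rc (interleave i β c))))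

    last-pigment : snoc β α (fromℕ k) ∙ e ≡ α
    last-pigment = ≡.trans (identityʳ _) (snoc-last k β α)

    eval-lhs : eval (rc (interleave i β c ++ (i , α) ∷ [])) ≡ eval (subst (rc lhs) σ)
    eval-lhs = begin
      eval (rc (interleave i β c ++ (i , α) ∷ []))   ≡⟨ eval-rc (interleave i β c ++ (i , α) ∷ []) ⟩
      interleave i β c ++ (i , α) ∷ []               ≡⟨ cong₂ (λ w γ → w ++ (i , γ) ∷ []) supP-rhs last-pigment ⟨
      supP rhs F ++ (i , snoc β α (fromℕ k) ∙ e) ∷ [] ≡⟨ supP-++ rhs _ F ⟨
      supP lhs F                                     ≡⟨ eval-subst-rc lhs σ ⟨
      eval (subst (rc lhs) σ)                        ∎
      where open ≡.≡-Reasoning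

  rc-↝ : ∀ {n} {w w′ : Word M n} → w ↝ w′ → rc w ≈ rc w′
  rc-↝ (delete b i α w k≤occ) =
    ≡.subst₂ (λ x y → rc x ≈ rc y) (≡.sym before) (≡.sym after)
      (rc-++-cong {x = prefix} refl (rc-++-cong {y = w} (rc-interleave-∷ʳ i pigments gaps α) refl))
    where
    open Interleaving (interleaving k i b k≤occ)
    I : Word M _
    I = interleave i pigments gaps
    before : b ++ (i , α) ∷ w ≡ prefix ++ (I ++ (i , α) ∷ []) ++ w
    before = begin
      b ++ (i , α) ∷ w                    ≡⟨ cong (_++ (i , α) ∷ w) split ⟩
      (prefix ++ I) ++ (i , α) ∷ w        ≡⟨ ++-assoc prefix I _ ⟩
      prefix ++ I ++ (i , α) ∷ w          ≡⟨ cong (prefix ++_) (++-assoc I _ w) ⟨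
      prefix ++ (I ++ (i , α) ∷ []) ++ w  ∎
      where open ≡.≡-Reasoning
    after : b ++ w ≡ prefix ++ I ++ w
    after = ≡.trans (cong (_++ w) split) (++-assoc prefix I w)

  rc-↝* : ∀ {n} {w w′ : Word M n} → w ↝* w′ → rc w ≈ rc w′
  rc-↝* = fold (λ w w′ → rc w ≈ rc w′) (λ w↝v → trans (rc-↝ w↝v)) refl

  rc-cong : ∀ {n} {w w′ : Word M n} → first k w ≡ first k w′ → rc w ≈ rc w′
  rc-cong {w = w} {w′} w≡w′ =
    trans (rc-↝* (↝*-first w)) (trans (≈-reflexive (cong rc w≡w′)) (sym (rc-↝* (↝*-first w′))))

proposition4p3p2 : ∀ {M : Set} (_∙_ : M → M → M) (e : M) → IsMonoid _≡_ _∙_ e →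
                   (k : ℕ) → CloneIso (Arra _∙_ e k) (TQ _∙_ e k)
proposition4p3p2 _∙_ e isMonoid k = record
  { to        = rc
  ; from      = eval
  ; to-cong   = rc-cong
  ; from-cong = eval-cong
  ; to-from   = rc-eval
  ; from-to   = λ w → cong (first k) (eval-rc w)
  ; to-sup    = rc-supP
  ; to-proj   = λ i → rc-eval (var i)
  }
  where open Presentation _∙_ e isMonoid k
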